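{- Let $W$ be one of $S_n$, $S^B_n$, $\widetilde{S}_n$, $\widetilde{S}^C_n$. If $w\in W$ is not the identity, then there exists a transposable pair $\{x,y\}$ for $W$ such that \[ w(x)\ge y> x\ge w(y). \]
   Context: Fix a positive integer $n$, $[n]=\{1,\dots,n\}$, $\pm[n]=\{\pm1,\dots,\pm n\}$. $S_n$: bijections of $[n]$. $S^B_n$: bijections $w$ of $\pm[n]$ with $w(-i)=-w(i)$. $\widetilde{S}_n$: bijections $w:\mathbb{Z}\to\mathbb{Z}$ with $w(i+n)=w(i)+n$ for all $i$ and $w(1)+\cdots+w(n)=\binom{n+1}{2}$. $\widetilde{S}^C_n$: bijections $w:\mathbb{Z}\to\mathbb{Z}$ with $w(-i)=-w(i)$ and $w(i+2n+2)=w(i)+2n+2$ for all $i$. A pair $\{x,y\}$ of distinct elements of the domain of $W$ is transposable for $W$ if there exists $u\in W$ with $u(x)=y$ and $u(y)=x$. -}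

module Defs where

open import Data.Nat using (ℕ; zero; suc)
open import Data.Nat.Combinatorics using (_C_)
open import Data.Integer using (ℤ; +_; _+_; _*_; -_; ∣_∣; _≤_; _<_)
open import Data.Product using (Σ; _×_; ∃; ∃-syntax)
open import Relation.Binary.PropositionalEquality using (_≡_; _≢_)
import Data.Nat as N
open import Data.Unit using (⊤)

data GroupType : Set where
  typeA typeB affineA affineC : GroupType

sumTo : ℕ → (ℤ → ℤ) → ℤ
sumTo zero    w = + 0
sumTo (suc k) w = sumTo k w + w (+ suc k)

-- w is a bijection of the subset D of ℤ (values of w outside D are irrelevant).
BijOn : (ℤ → Set) → (ℤ → ℤ) → Set
BijOn D w =
  (∀ x → D x → D (w x)) ×
  (∀ x y → D x → D y → w x ≡ w y → x ≡ y) ×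
  (∀ y → D y → ∃[ x ] (D x × w x ≡ y))

Dom : GroupType → ℕ → ℤ → Set
Dom typeA   n x = (+ 1 ≤ x) × (x ≤ + n)
Dom typeB   n x = (1 N.≤ ∣ x ∣) × (∣ x ∣ N.≤ n)
Dom affineA n x = ⊤
Dom affineC n x = ⊤

InW : GroupType → ℕ → (ℤ → ℤ) → Set
InW typeA   n w = BijOn (Dom typeA n) w
InW typeB   n w = BijOn (Dom typeB n) w × (∀ i → Dom typeB n i → w (- i) ≡ - w i)
InW affineA n w = BijOn (Dom affineA n) w
                × (∀ i → w (i + + n) ≡ w i + + n)
                × (sumTo n w ≡ + (suc n C 2))
InW affineC n w = BijOn (Dom affineC n) w
                × (∀ i → w (- i) ≡ - w i)
                × (∀ i → w (i + + (2 N.* n N.+ 2)) ≡ w i + + (2 N.* n N.+ 2))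

IsIdentity : GroupType → ℕ → (ℤ → ℤ) → Set
IsIdentity W n w = ∀ x → Dom W n x → w x ≡ x

Transposable : GroupType → ℕ → ℤ → ℤ → Set
Transposable W n x y =
  Dom W n x × Dom W n y × x ≢ y ×
  ∃[ u ] (InW W n u × u x ≡ y × u y ≡ x)

-- Call (x, y) with w y ≤ x < y ≤ w x a crossing of w. In all four groups w is injective,
-- moves every point by a bounded amount, and is balanced: when an element jumps across the
-- cut between c and c + 1 in one direction, another one jumps across it in the other
-- direction (by pigeonhole for S_n and S^B_n; for the affine groups because the sum of
-- w i - i over a period vanishes). Starting at a point moved by w and following matching
-- jumps, either a crossing appears or the jump strictly grows, which the bound forbids.
-- The points of a crossing are never congruent modulo the period (nor, in the signed groups,
-- self-opposite), so exchanging the residue classes of x and y, and in the signed groups also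
-- those of -y and -x, gives an element of W that swaps x and y.

module Submission where

open import Algebra.Bundles using (AbelianGroup)
open import Data.Empty using (⊥; ⊥-elim)
open import Data.Fin using (toℕ; fromℕ<)
import Data.Fin.Properties as Fin
open import Data.Integer as ℤ using (ℤ; +_; -[1+_]; _+_; _-_; -_; _*_; _≤_; _<_; ∣_∣; _≤?_; _≟_)
open import Data.Integer.DivMod using (_%ℕ_; _/ℕ_; a≡a%ℕn+[a/ℕn]*n; n%ℕd<d)
open import Data.Integer.Divisibility.Signed
  using (_∣_; divides; _∣?_; ∣-refl; ∣m∣n⇒∣m+n; ∣m∣n⇒∣m-n; ∣m⇒∣-m; ∣m+n∣n⇒∣m)
open import Data.Integer.Properties
open import Data.Integer.Tactic.RingSolver using (solve-∀)
open import Data.Nat as ℕ using (ℕ; zero; suc; _/_; _%_)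
open import Data.Nat.Combinatorics using (_C_; nC1≡n; nCk+nC[k+1]≡[n+1]C[k+1])
open import Data.Nat.DivMod using (m≡m%n+[m/n]*n; m%n<n; m/n≡0⇒m<n; [m+kn]%n≡m%n; m<n⇒m%n≡m)
import Data.Nat.Properties as ℕ
import Data.Nat.Tactic.RingSolver as ℕ-Solver
open import Data.Product using (_,_; proj₁; proj₂; ∃-syntax; ∃₂; _×_)
open import Data.Sum as Sum using (_⊎_; inj₁; inj₂)
open import Data.Unit using (⊤; tt)
open import Function using (_∘_)
open import Relation.Binary.Definitions using (tri<; tri≈; tri>)
open import Relation.Binary.PropositionalEquality
open import Relation.Nullary using (¬_; Dec; yes; no; ¬?)
open import Relation.Nullary.Decidable using (map′; _⊎-dec_; decidable-stable)
open import Relation.Unary using (Decidable)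

open import Algebra.Properties.CommutativeSemigroup ℕ.+-commutativeSemigroup using (xy∙z≈xz∙y)
open import Algebra.Properties.Group (AbelianGroup.group +-0-abelianGroup)
  using () renaming (∙-cancelˡ to +-cancelˡ-≡)

open import Defs

-- Sums and injections on ℕ

∑< : ℕ → (ℕ → ℕ) → ℕ
∑< zero    f = 0
∑< (suc n) f = ∑< n f ℕ.+ f n

syntax ∑< n (λ i → e) = ∑[ i < n ] e

InjectiveBelow : ℕ → (ℕ → ℕ) → Set
InjectiveBelow n f = ∀ {i j} → i ℕ.< n → j ℕ.< n → f i ≡ f j → i ≡ j

∑-cong : ∀ n {f g} → (∀ {i} → i ℕ.< n → f i ≡ g i) → ∑< n f ≡ ∑< n g
∑-cong zero    f≗g = refl
∑-cong (suc n) f≗g =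
  cong₂ ℕ._+_ (∑-cong n (λ i<n → f≗g (ℕ.m<n⇒m<1+n i<n))) (f≗g ℕ.≤-refl)

∑-linear : ∀ n f g k → ∑[ i < n ] (f i ℕ.+ g i ℕ.* k) ≡ ∑< n f ℕ.+ ∑< n g ℕ.* k
∑-linear zero    f g k = refl
∑-linear (suc n) f g k rewrite ∑-linear n f g k = regroup (∑< n f) (∑< n g) (f n) (g n) k
  where
  regroup : ∀ a b c d k → a ℕ.+ b ℕ.* k ℕ.+ (c ℕ.+ d ℕ.* k) ≡ a ℕ.+ c ℕ.+ (b ℕ.+ d) ℕ.* k
  regroup = ℕ-Solver.solve-∀

term≤∑ : ∀ {n k} f → k ℕ.< n → f k ℕ.≤ ∑< n f
term≤∑ {suc n} {k} f k<1+n with ℕ.m≤n⇒m<n∨m≡n (ℕ.s≤s⁻¹ k<1+n)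
... | inj₁ k<n = ℕ.≤-trans (term≤∑ f k<n) (ℕ.m≤m+n (∑< n f) (f n))
... | inj₂ refl = ℕ.m≤n+m (f k) (∑< k f)

pigeonhole-ℕ : ∀ {n f} → (∀ {i} → i ℕ.< suc n → f i ℕ.< n) → ¬ InjectiveBelow (suc n) f
pigeonhole-ℕ {n} {f} bounded injective
  with i , j , i<j , same ← Fin.pigeonhole ℕ.≤-refl (λ k → fromℕ< (bounded (Fin.toℕ<n k)))
  = ℕ.<-irrefl (injective (Fin.toℕ<n i) (Fin.toℕ<n j) f[i]≡f[j]) i<j
  where
  f[i]≡f[j] : f (toℕ i) ≡ f (toℕ j)
  f[i]≡f[j] = trans (sym (Fin.toℕ-fromℕ< _)) (trans (cong toℕ same) (Fin.toℕ-fromℕ< _))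

_[_]≔_ : (ℕ → ℕ) → ℕ → ℕ → ℕ → ℕ
(f [ j ]≔ v) i with i ℕ.≟ j
... | yes _ = v
... | no  _ = f i

[]≔-≡ : ∀ f {i j} → i ≡ j → ∀ v → (f [ j ]≔ v) i ≡ v
[]≔-≡ f {i} {j} i≡j v with i ℕ.≟ j
... | yes _   = refl
... | no  i≢j = ⊥-elim (i≢j i≡j)

[]≔-≢ : ∀ f {i j} v → i ≢ j → (f [ j ]≔ v) i ≡ f i
[]≔-≢ f {i} {j} v i≢j with i ℕ.≟ j
... | yes i≡j = ⊥-elim (i≢j i≡j)
... | no  _   = refl

∑-[]≔-outside : ∀ n f {j} v → n ℕ.≤ j → ∑< n (f [ j ]≔ v) ≡ ∑< n f
∑-[]≔-outside n f v n≤j = ∑-cong n (λ i<n → []≔-≢ f v (ℕ.<⇒≢ (ℕ.<-≤-trans i<n n≤j)))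

∑-[]≔-inside : ∀ n f {j} v → j ℕ.< n → ∑< n (f [ j ]≔ v) ℕ.+ f j ≡ ∑< n f ℕ.+ v
∑-[]≔-inside (suc n) f {j} v j<1+n with ℕ.m≤n⇒m<n∨m≡n (ℕ.s≤s⁻¹ j<1+n)
... | inj₂ refl = begin
  ∑< n (f [ n ]≔ v) ℕ.+ (f [ n ]≔ v) n ℕ.+ f n
    ≡⟨ cong₂ (λ a b → a ℕ.+ b ℕ.+ f n) (∑-[]≔-outside n f v ℕ.≤-refl) ([]≔-≡ f {n} refl v) ⟩
  ∑< n f ℕ.+ v ℕ.+ f n
    ≡⟨ xy∙z≈xz∙y (∑< n f) v (f n) ⟩
  ∑< n f ℕ.+ f n ℕ.+ v ∎
  where open ≡-Reasoning
... | inj₁ j<n = begin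
  ∑< n (f [ j ]≔ v) ℕ.+ (f [ j ]≔ v) n ℕ.+ f j
    ≡⟨ cong (λ b → ∑< n (f [ j ]≔ v) ℕ.+ b ℕ.+ f j) ([]≔-≢ f v (ℕ.>⇒≢ j<n)) ⟩
  ∑< n (f [ j ]≔ v) ℕ.+ f n ℕ.+ f j
    ≡⟨ xy∙z≈xz∙y (∑< n (f [ j ]≔ v)) (f n) (f j) ⟩
  ∑< n (f [ j ]≔ v) ℕ.+ f j ℕ.+ f n
    ≡⟨ cong (ℕ._+ f n) (∑-[]≔-inside n f v j<n) ⟩
  ∑< n f ℕ.+ v ℕ.+ f n
    ≡⟨ xy∙z≈xz∙y (∑< n f) v (f n) ⟩
  ∑< n f ℕ.+ f n ℕ.+ v ∎
  where open ≡-Reasoning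

-- Some f j is at least n (pigeonhole); moving f n into slot j leaves an injection below n.
∑-id≤∑-injective : ∀ n {f} → InjectiveBelow n f → ∑[ i < n ] i ℕ.≤ ∑< n f
∑-id≤∑-injective zero    _ = ℕ.z≤n
∑-id≤∑-injective (suc n) {f} injective with ℕ.anyUpTo? (λ j → n ℕ.≤? f j) (suc n)
... | no none = ⊥-elim (pigeonhole-ℕ (λ i<1+n → ℕ.≰⇒> (λ n≤f[i] → none (_ , i<1+n , n≤f[i]))) injective)
... | yes (j , j<1+n , n≤f[j]) = begin
  ∑[ i < n ] i ℕ.+ n    ≤⟨ ℕ.+-mono-≤ (∑-id≤∑-injective n g-injective) n≤f[j] ⟩
  ∑< n g ℕ.+ f j        ≡⟨ ∑-g ⟩
  ∑< n f ℕ.+ f n        ∎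
  where
  open ℕ.≤-Reasoning
  g = f [ j ]≔ f n

  ∑-g : ∑< n g ℕ.+ f j ≡ ∑< n f ℕ.+ f n
  ∑-g with ℕ.m≤n⇒m<n∨m≡n (ℕ.s≤s⁻¹ j<1+n)
  ... | inj₁ j<n  = ∑-[]≔-inside n f (f n) j<n
  ... | inj₂ refl = cong (ℕ._+ f n) (∑-[]≔-outside n f (f n) ℕ.≤-refl)

  f[n]≢f : ∀ {i} → i ℕ.< n → f n ≢ f i
  f[n]≢f i<n f[n]≡f[i] = ℕ.>⇒≢ i<n (injective ℕ.≤-refl (ℕ.m<n⇒m<1+n i<n) f[n]≡f[i])

  g-injective : InjectiveBelow n g
  g-injective {i} {i′} i<n i′<n g[i]≡g[i′] = by-cases (i ℕ.≟ j) (i′ ℕ.≟ j)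
    where
    by-cases : Dec (i ≡ j) → Dec (i′ ≡ j) → i ≡ i′
    by-cases (yes i≡j) (yes i′≡j) = trans i≡j (sym i′≡j)
    by-cases (yes i≡j) (no i′≢j)  = ⊥-elim (f[n]≢f i′<n (begin-equality
      f n   ≡⟨ []≔-≡ f i≡j (f n) ⟨
      g i   ≡⟨ g[i]≡g[i′] ⟩
      g i′  ≡⟨ []≔-≢ f (f n) i′≢j ⟩
      f i′  ∎))
    by-cases (no i≢j)  (yes i′≡j) = ⊥-elim (f[n]≢f i<n (begin-equality
      f n   ≡⟨ []≔-≡ f i′≡j (f n) ⟨
      g i′  ≡⟨ g[i]≡g[i′] ⟨
      g i   ≡⟨ []≔-≢ f (f n) i≢j ⟩
      f i   ∎))
    by-cases (no i≢j)  (no i′≢j)  = injective (ℕ.m<n⇒m<1+n i<n) (ℕ.m<n⇒m<1+n i′<n) (begin-equality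
      f i   ≡⟨ []≔-≢ f (f n) i≢j ⟨
      g i   ≡⟨ g[i]≡g[i′] ⟩
      g i′  ≡⟨ []≔-≢ f (f n) i′≢j ⟩
      f i′  ∎)

-- Being distinct, the residues v i % P alone already sum to at least ∑ i, so every
-- quotient v i / P vanishes.
bounded-by-distinct-residues : ∀ P .{{_ : ℕ.NonZero P}} (v : ℕ → ℕ) →
  InjectiveBelow P (λ i → v i % P) → ∑< P v ≡ ∑[ i < P ] i → ∀ {k} → k ℕ.< P → v k ℕ.< P
bounded-by-distinct-residues P v residues-injective ∑v≡∑id {k} k<P =
  m/n≡0⇒m<n (ℕ.n≤0⇒n≡0 (ℕ.≤-trans (term≤∑ (λ i → v i / P) k<P) (ℕ.≤-reflexive ∑q≡0)))
  where
  ∑r = ∑[ i < P ] (v i % P)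
  ∑q = ∑[ i < P ] (v i / P)

  ∑v≡∑r+∑q*P : ∑< P v ≡ ∑r ℕ.+ ∑q ℕ.* P
  ∑v≡∑r+∑q*P = trans (∑-cong P (λ {i} _ → m≡m%n+[m/n]*n (v i) P))
                     (∑-linear P (λ i → v i % P) (λ i → v i / P) P)

  ∑q*P≤0 : ∑q ℕ.* P ℕ.≤ 0
  ∑q*P≤0 = ℕ.+-cancelˡ-≤ (∑[ i < P ] i) _ _ (begin
    ∑[ i < P ] i ℕ.+ ∑q ℕ.* P   ≤⟨ ℕ.+-monoˡ-≤ _ (∑-id≤∑-injective P residues-injective) ⟩
    ∑r ℕ.+ ∑q ℕ.* P            ≡⟨ trans (sym ∑v≡∑r+∑q*P) ∑v≡∑id ⟩
    ∑[ i < P ] i               ≡⟨ ℕ.+-identityʳ _ ⟨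
    ∑[ i < P ] i ℕ.+ 0         ∎)
    where open ℕ.≤-Reasoning

  ∑q≡0 : ∑q ≡ 0
  ∑q≡0 = ℕ.m*n≡0⇒m≡0 ∑q P (ℕ.n≤0⇒n≡0 ∑q*P≤0)


infix 4 _∈[_,_]
_∈[_,_] : ℤ → ℤ → ℤ → Set
i ∈[ a , b ] = a ≤ i × i ≤ b

a+∣i-a∣≡i : ∀ {a i} → a ≤ i → a + + ∣ i - a ∣ ≡ i
a+∣i-a∣≡i {a} {i} a≤i = begin
  a + + ∣ i - a ∣  ≡⟨ cong (λ d → a + d) (0≤i⇒+∣i∣≡i (i≤j⇒0≤j-i a≤i)) ⟩
  a + (i - a)      ≡⟨ a+[i-a]≡i a i ⟩
  i                ∎
  where
  open ≡-Reasoning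
  a+[i-a]≡i : ∀ a i → a + (i - a) ≡ i
  a+[i-a]≡i = solve-∀

∣i-a∣≤∣b-a∣ : ∀ {a b i} → i ∈[ a , b ] → ∣ i - a ∣ ℕ.≤ ∣ b - a ∣
∣i-a∣≤∣b-a∣ {a} {b} {i} (a≤i , i≤b) = drop‿+≤+ (begin
  + ∣ i - a ∣  ≡⟨ 0≤i⇒+∣i∣≡i (i≤j⇒0≤j-i a≤i) ⟩
  i - a        ≤⟨ +-monoˡ-≤ (- a) i≤b ⟩
  b - a        ≡⟨ 0≤i⇒+∣i∣≡i (i≤j⇒0≤j-i (≤-trans a≤i i≤b)) ⟨
  + ∣ b - a ∣  ∎)
  where open ≤-Reasoning

a+k∈[a,b] : ∀ {a b k} → a ≤ b → k ℕ.≤ ∣ b - a ∣ → a + + k ∈[ a , b ]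
a+k∈[a,b] {a} {b} {k} a≤b k≤∣b-a∣ = i≤i+j a (+ k) , (begin
  a + + k          ≤⟨ +-monoʳ-≤ a (ℤ.+≤+ k≤∣b-a∣) ⟩
  a + + ∣ b - a ∣  ≡⟨ a+∣i-a∣≡i a≤b ⟩
  b                ∎)
  where open ≤-Reasoning

∣-a∣-injective : ∀ {a i j} → a ≤ i → a ≤ j → ∣ i - a ∣ ≡ ∣ j - a ∣ → i ≡ j
∣-a∣-injective {a} a≤i a≤j eq =
  trans (sym (a+∣i-a∣≡i a≤i)) (trans (cong (λ k → a + + k) eq) (a+∣i-a∣≡i a≤j))

search : ∀ {P : ℤ → Set} → Decidable P → ∀ a b →
  (∃[ i ] (i ∈[ a , b ] × P i)) ⊎ (∀ {i} → i ∈[ a , b ] → ¬ P i)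
search {P} P? a b with a ≤? b
... | no a≰b = inj₂ (λ (a≤i , i≤b) _ → a≰b (≤-trans a≤i i≤b))
... | yes a≤b with ℕ.anyUpTo? (λ k → P? (a + + k)) (suc ∣ b - a ∣)
...   | yes (k , k<1+n , Pk) = inj₁ (a + + k , a+k∈[a,b] a≤b (ℕ.s≤s⁻¹ k<1+n) , Pk)
...   | no none = inj₂ λ {i} i∈[a,b] Pi →
  none (∣ i - a ∣ , ℕ.s≤s (∣i-a∣≤∣b-a∣ i∈[a,b]) , subst P (sym (a+∣i-a∣≡i (proj₁ i∈[a,b]))) Pi)

no-injection-into-range : ∀ {f : ℤ → ℤ} {p a b} → p < a →
  (∀ {i} → i ≡ p ⊎ i ∈[ a , b ] → f i ∈[ a , b ]) →
  (∀ {i j} → i ≡ p ⊎ i ∈[ a , b ] → j ≡ p ⊎ j ∈[ a , b ] → f i ≡ f j → i ≡ j) → ⊥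
no-injection-into-range {f} {p} {a} {b} p<a maps-into injective =
  pigeonhole-ℕ index-bounded index-injective
  where
  a≤b = ≤-trans (proj₁ (maps-into (inj₁ refl))) (proj₂ (maps-into (inj₁ refl)))
  n = ∣ b - a ∣

  point : ℕ → ℤ
  point zero    = p
  point (suc k) = a + + k

  point∈ : ∀ {k} → k ℕ.< suc (suc n) → point k ≡ p ⊎ point k ∈[ a , b ]
  point∈ {zero}  _     = inj₁ refl
  point∈ {suc k} k<2+n = inj₂ (a+k∈[a,b] a≤b (ℕ.s≤s⁻¹ (ℕ.s≤s⁻¹ k<2+n)))

  p<point : ∀ k → p < point (suc k)
  p<point k = <-≤-trans p<a (i≤i+j a (+ k))

  point-injective : ∀ {k l} → point k ≡ point l → k ≡ l
  point-injective {zero}  {zero}  _  = refl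
  point-injective {zero}  {suc l} eq = ⊥-elim (<⇒≢ (p<point l) eq)
  point-injective {suc k} {zero}  eq = ⊥-elim (<⇒≢ (p<point k) (sym eq))
  point-injective {suc k} {suc l} eq = cong suc (+-injective (+-cancelˡ-≡ a _ _ eq))

  index : ℕ → ℕ
  index k = ∣ f (point k) - a ∣

  index-bounded : ∀ {k} → k ℕ.< suc (suc n) → index k ℕ.< suc n
  index-bounded k<2+n = ℕ.s≤s (∣i-a∣≤∣b-a∣ (maps-into (point∈ k<2+n)))

  index-injective : InjectiveBelow (suc (suc n)) index
  index-injective k< l< eq = point-injective (injective (point∈ k<) (point∈ l<)
    (∣-a∣-injective (proj₁ (maps-into (point∈ k<))) (proj₁ (maps-into (point∈ l<))) eq))

c+suc[k]∈[suc[c],c+n] : ∀ {c k n} → k ℕ.< n → c + + suc k ∈[ ℤ.suc c , c + + n ]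
c+suc[k]∈[suc[c],c+n] {c} {k} {n} k<n =
  subst (ℤ.suc c ≤_) (sym (c+suc[k]≡suc[c]+k c (+ k))) (i≤i+j (ℤ.suc c) (+ k)) ,
  +-monoʳ-≤ c (ℤ.+≤+ k<n)
  where
  c+suc[k]≡suc[c]+k : ∀ c k → c + (+ 1 + k) ≡ + 1 + c + k
  c+suc[k]≡suc[c]+k = solve-∀

∈[suc[c],c+n]⇒offset : ∀ {c i n} → i ∈[ ℤ.suc c , c + + n ] → ∃[ k ] (k ℕ.< n × i ≡ c + + suc k)
∈[suc[c],c+n]⇒offset {c} {i} {n} (c<i , i≤c+n) = k , drop‿+≤+ (begin
    + 1 + + k        ≡⟨ cong (λ d → + 1 + d) +k≡i-suc[c] ⟩
    + 1 + (i - ℤ.suc c) ≡⟨ 1+[i-1-c]≡i-c c i ⟩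
    i - c            ≤⟨ +-monoˡ-≤ (- c) i≤c+n ⟩
    c + + n - c      ≡⟨ c+n-c≡n c (+ n) ⟩
    + n              ∎) ,
  (begin-equality
    i                       ≡⟨ i≡c+[1+[i-1-c]] c i ⟩
    c + (+ 1 + (i - ℤ.suc c)) ≡⟨ cong (λ d → c + (+ 1 + d)) +k≡i-suc[c] ⟨
    c + + suc k             ∎)
  where
  open ≤-Reasoning
  k = ∣ i - ℤ.suc c ∣
  +k≡i-suc[c] : + k ≡ i - ℤ.suc c
  +k≡i-suc[c] = 0≤i⇒+∣i∣≡i (i≤j⇒0≤j-i c<i)
  1+[i-1-c]≡i-c : ∀ c i → + 1 + (i - (+ 1 + c)) ≡ i - c
  1+[i-1-c]≡i-c = solve-∀
  c+n-c≡n : ∀ c n → c + n - c ≡ n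
  c+n-c≡n = solve-∀
  i≡c+[1+[i-1-c]] : ∀ c i → i ≡ c + (+ 1 + (i - (+ 1 + c)))
  i≡c+[1+[i-1-c]] = solve-∀

∣i∣≤n⇒i∈[-n,n] : ∀ {i n} → ∣ i ∣ ℕ.≤ n → i ∈[ - + n , + n ]
∣i∣≤n⇒i∈[-n,n] {+ m}      m≤n   = neg-≤-pos , ℤ.+≤+ m≤n
∣i∣≤n⇒i∈[-n,n] { -[1+ m ]} 1+m≤n = neg-mono-≤ (ℤ.+≤+ 1+m≤n) , ℤ.-≤+

i≡-i⇒i≡0 : ∀ {i} → i ≡ - i → i ≡ + 0
i≡-i⇒i≡0 {+ zero}    _  = refl
i≡-i⇒i≡0 {+ suc _}   ()
i≡-i⇒i≡0 { -[1+ _ ]} ()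

nonFixed-in-range : ∀ {w : ℤ → ℤ} {a b} → ¬ (∀ {i} → i ∈[ a , b ] → w i ≡ i) →
  ∃[ x ] (x ∈[ a , b ] × w x ≢ x)
nonFixed-in-range {w} {a} {b} not-identity with search (λ i → ¬? (w i ≟ i)) a b
... | inj₁ found = found
... | inj₂ none  = ⊥-elim (not-identity (λ i∈ → decidable-stable (w _ ≟ _) (none i∈)))

-- Crossings of balanced maps

Crossing : (ℤ → ℤ) → ℤ → ℤ → Set
Crossing w x y = y ≤ w x × x < y × w y ≤ x

CrossingIn : (ℤ → Set) → (ℤ → ℤ) → Set
CrossingIn D w = ∃₂ λ x y → D x × D y × Crossing w x y

RightBalanced : (ℤ → Set) → (ℤ → ℤ) → Set
RightBalanced D w = ∀ {c p} → D p → p ≤ c → c < w p → ∃[ q ] (D q × c < q × w q ≤ c)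

LeftBalanced : (ℤ → Set) → (ℤ → ℤ) → Set
LeftBalanced D w = ∀ {c q} → D q → c < q → w q ≤ c → ∃[ p ] (D p × p ≤ c × c < w p)

Balanced : (ℤ → Set) → (ℤ → ℤ) → Set
Balanced D w = RightBalanced D w × LeftBalanced D w

rightBalanced-⇔ : ∀ {D D′ w} → (∀ {i} → D′ i → D i) → (∀ {i} → D i → D′ i) →
  RightBalanced D w → RightBalanced D′ w
rightBalanced-⇔ to from right p∈ p≤c c<wp with right (to p∈) p≤c c<wp
... | q , q∈ , c<q , wq≤c = q , from q∈ , c<q , wq≤c

mirror : (ℤ → ℤ) → ℤ → ℤ
mirror w i = - w (- i)

leftBalanced-mirror : ∀ {D w} → RightBalanced (λ i → D (- i)) (mirror w) → LeftBalanced D w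
leftBalanced-mirror {D} {w} right {c} {q} q∈D c<q w[q]≤c = mirror-back (right -q∈D° -q≤-1-c -1-c<w°[-q])
  where
  -q∈D° : D (- - q)
  -q∈D° = subst D (sym (neg-involutive q)) q∈D

  -q≤-1-c : - q ≤ - ℤ.suc c
  -q≤-1-c = neg-mono-≤ (i<j⇒suc[i]≤j c<q)

  -1-c<w°[-q] : - ℤ.suc c < mirror w (- q)
  -1-c<w°[-q] = subst (λ j → - ℤ.suc c < - w j) (sym (neg-involutive q))
                      (neg-mono-< (≤-<-trans w[q]≤c (suc[i]≤j⇒i<j ≤-refl)))

  mirror-back : ∃[ q′ ] (D (- q′) × - ℤ.suc c < q′ × mirror w q′ ≤ - ℤ.suc c) →
                ∃[ p ] (D p × p ≤ c × c < w p)
  mirror-back (q′ , q′∈D° , -1-c<q′ , w°[q′]≤-1-c) =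
    - q′ ,
    q′∈D° ,
    subst (- q′ ≤_) (pred-suc c)
      (i<j⇒i≤pred[j] (subst (- q′ <_) (neg-involutive _) (neg-mono-< -1-c<q′))) ,
    suc[i]≤j⇒i<j (neg-cancel-≤ w°[q′]≤-1-c)

module _ {D : ℤ → Set} {w : ℤ → ℤ} {L : ℕ}
         (bounded : ∀ {i} → D i → ∣ w i - i ∣ ℕ.≤ L) (balanced : Balanced D w) where

  private
    jump : ℤ → ℕ
    jump x = ∣ w x - x ∣

    +jump-up : ∀ {x} → x ≤ w x → + jump x ≡ w x - x
    +jump-up {x} x≤wx = trans (cong +_ (∣i-j∣≡∣j-i∣ (w x) x)) (∣-∣-≤ x≤wx)

    +jump-down : ∀ {x} → w x ≤ x → + jump x ≡ x - w x
    +jump-down = ∣-∣-≤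

    LargerJump : ℤ → Set
    LargerJump x = ∃[ x′ ] (D x′ × w x′ ≢ x′ × jump x ℕ.< jump x′)

    step-up : ∀ {x} → D x → x < w x → CrossingIn D w ⊎ LargerJump x
    step-up {x} x∈D x<wx with proj₁ balanced x∈D ≤-refl x<wx
    ... | q , q∈D , x<q , wq≤x with q ≤? w x
    ...   | yes q≤wx = inj₁ (x , q , x∈D , q∈D , q≤wx , x<q , wq≤x)
    ...   | no  q≰wx = inj₂ (q , q∈D , <⇒≢ (≤-<-trans wq≤x x<q) , drop‿+<+ (begin-strict
      + jump x   ≡⟨ +jump-up (<⇒≤ x<wx) ⟩
      w x - x    <⟨ +-monoˡ-< (- x) (≰⇒> q≰wx) ⟩
      q - x      ≤⟨ +-monoʳ-≤ q (neg-mono-≤ wq≤x) ⟩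
      q - w q    ≡⟨ +jump-down (≤-trans wq≤x (<⇒≤ x<q)) ⟨
      + jump q   ∎))
      where open ≤-Reasoning

    step-down : ∀ {y} → D y → w y < y → CrossingIn D w ⊎ LargerJump y
    step-down {y} y∈D wy<y with proj₂ balanced y∈D (i≤pred[j]⇒i<j ≤-refl) (i<j⇒i≤pred[j] wy<y)
    ... | p , p∈D , p≤y-1 , y-1<wp with w y ≤? p
    ...   | yes wy≤p = inj₁ (p , y , p∈D , y∈D , y≤wp , i≤pred[j]⇒i<j p≤y-1 , wy≤p)
      where y≤wp = subst (_≤ w p) (suc-pred y) (i<j⇒suc[i]≤j y-1<wp)
    ...   | no  wy≰p = inj₂ (p , p∈D , ≢-sym (<⇒≢ (<-trans p<wy (<-≤-trans wy<y y≤wp))) ,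
                              drop‿+<+ (begin-strict
      + jump y   ≡⟨ +jump-down (<⇒≤ wy<y) ⟩
      y - w y    ≤⟨ +-monoˡ-≤ (- w y) y≤wp ⟩
      w p - w y  <⟨ +-monoʳ-< (w p) (neg-mono-< p<wy) ⟩
      w p - p    ≡⟨ +jump-up (<⇒≤ (<-trans p<wy (<-≤-trans wy<y y≤wp))) ⟨
      + jump p   ∎))
      where
      open ≤-Reasoning
      y≤wp = subst (_≤ w p) (suc-pred y) (i<j⇒suc[i]≤j y-1<wp)
      p<wy = ≰⇒> wy≰p

    step : ∀ {x} → D x → w x ≢ x → CrossingIn D w ⊎ LargerJump x
    step {x} x∈D wx≢x with <-cmp x (w x)
    ... | tri< x<wx _ _ = step-up x∈D x<wx
    ... | tri≈ _ x≡wx _ = ⊥-elim (wx≢x (sym x≡wx))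
    ... | tri> _ _ wx<x = step-down x∈D wx<x

    -- The jump grows strictly along the walk and never exceeds L, so L + 1 steps suffice.
    walk : ∀ k {x} → D x → w x ≢ x → L ℕ.< jump x ℕ.+ k → CrossingIn D w
    walk zero    x∈D _ L<jump = ⊥-elim (ℕ.<⇒≱ (subst (L ℕ.<_) (ℕ.+-identityʳ _) L<jump) (bounded x∈D))
    walk (suc k) {x} x∈D wx≢x L<jump+1+k with step x∈D wx≢x
    ... | inj₁ crossing = crossing
    ... | inj₂ (x′ , x′∈D , wx′≢x′ , jump<jump′) = walk k x′∈D wx′≢x′ (begin-strict
      L                  <⟨ L<jump+1+k ⟩
      jump x ℕ.+ suc k   ≡⟨ ℕ.+-suc (jump x) k ⟩
      suc (jump x) ℕ.+ k ≤⟨ ℕ.+-monoˡ-≤ k jump<jump′ ⟩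
      jump x′ ℕ.+ k      ∎)
      where open ℕ.≤-Reasoning

  crossing-from-nonFixed : ∀ {x} → D x → w x ≢ x → CrossingIn D w
  crossing-from-nonFixed {x} x∈D wx≢x = walk (suc L) x∈D wx≢x (ℕ.m≤n+m (suc L) (jump x))

crossing-moves-left : ∀ {w x y} → Crossing w x y → w x ≢ x
crossing-moves-left (y≤wx , x<y , _) wx≡x = <⇒≱ x<y (subst (_ ≤_) wx≡x y≤wx)

crossing-moves-right : ∀ {w x y} → Crossing w x y → w y ≢ y
crossing-moves-right (_ , x<y , wy≤x) wy≡y = <⇒≱ x<y (subst (_≤ _) wy≡y wy≤x)

∣j-i∣≤∣b-a∣ : ∀ {a b i j} → i ∈[ a , b ] → j ∈[ a , b ] → ∣ j - i ∣ ℕ.≤ ∣ b - a ∣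
∣j-i∣≤∣b-a∣ {a} {b} {i} {j} (a≤i , i≤b) (a≤j , j≤b) with ≤-total i j
... | inj₁ i≤j = drop‿+≤+ (begin
  + ∣ j - i ∣  ≡⟨ cong +_ (∣i-j∣≡∣j-i∣ j i) ⟩
  + ∣ i - j ∣  ≡⟨ ∣-∣-≤ i≤j ⟩
  j - i        ≤⟨ +-mono-≤ j≤b (neg-mono-≤ a≤i) ⟩
  b - a        ≡⟨ ∣-∣-≤ (≤-trans a≤i i≤b) ⟨
  + ∣ a - b ∣  ≡⟨ cong +_ (∣i-j∣≡∣j-i∣ a b) ⟩
  + ∣ b - a ∣  ∎)
  where open ≤-Reasoning
... | inj₂ j≤i = drop‿+≤+ (begin
  + ∣ j - i ∣  ≡⟨ ∣-∣-≤ j≤i ⟩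
  i - j        ≤⟨ +-mono-≤ i≤b (neg-mono-≤ a≤j) ⟩
  b - a        ≡⟨ ∣-∣-≤ (≤-trans a≤i i≤b) ⟨
  + ∣ a - b ∣  ≡⟨ cong +_ (∣i-j∣≡∣j-i∣ a b) ⟩
  + ∣ b - a ∣  ∎)
  where open ≤-Reasoning

neg-∈[] : ∀ {a b i} → i ∈[ a , b ] → - i ∈[ - b , - a ]
neg-∈[] (a≤i , i≤b) = neg-mono-≤ i≤b , neg-mono-≤ a≤i

∈[-b,-a]⇒-∈[a,b] : ∀ {a b i} → i ∈[ - b , - a ] → - i ∈[ a , b ]
∈[-b,-a]⇒-∈[a,b] {a} {b} {i} (-b≤i , i≤-a) =
  subst (_≤ - i) (neg-involutive a) (neg-mono-≤ i≤-a) ,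
  subst (- i ≤_) (neg-involutive b) (neg-mono-≤ -b≤i)

-∈[a,b]⇒∈[-b,-a] : ∀ {a b i} → - i ∈[ a , b ] → i ∈[ - b , - a ]
-∈[a,b]⇒∈[-b,-a] {i = i} -i∈[a,b] = subst (_∈[ _ , _ ]) (neg-involutive i) (neg-∈[] -i∈[a,b])

rightBalanced-range : ∀ {w a b} → (∀ {i} → i ∈[ a , b ] → w i ∈[ a , b ]) →
  (∀ {i j} → i ∈[ a , b ] → j ∈[ a , b ] → w i ≡ w j → i ≡ j) → RightBalanced (_∈[ a , b ]) w
rightBalanced-range {w} {a} {b} maps-into injective {c} {p} p∈[a,b] p≤c c<wp
  with search (λ q → w q ≤? c) (ℤ.suc c) b
... | inj₁ (q , (c<q , q≤b) , wq≤c) =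
  q , (≤-trans (proj₁ p∈[a,b]) (≤-trans p≤c (<⇒≤ (suc[i]≤j⇒i<j c<q))) , q≤b) ,
  suc[i]≤j⇒i<j c<q , wq≤c
... | inj₂ none = ⊥-elim (no-injection-into-range (≤-<-trans p≤c (suc[i]≤j⇒i<j ≤-refl))
                            maps-above-c (λ i∈ j∈ → injective (∈[a,b] i∈) (∈[a,b] j∈)))
  where
  ∈[a,b] : ∀ {i} → i ≡ p ⊎ i ∈[ ℤ.suc c , b ] → i ∈[ a , b ]
  ∈[a,b] (inj₁ refl)        = p∈[a,b]
  ∈[a,b] (inj₂ (c<i , i≤b)) = ≤-trans (proj₁ p∈[a,b]) (≤-trans p≤c (<⇒≤ (suc[i]≤j⇒i<j c<i))) , i≤b

  maps-above-c : ∀ {i} → i ≡ p ⊎ i ∈[ ℤ.suc c , b ] → w i ∈[ ℤ.suc c , b ]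
  maps-above-c (inj₁ refl) = i<j⇒suc[i]≤j c<wp , proj₂ (maps-into p∈[a,b])
  maps-above-c (inj₂ i∈)   = i<j⇒suc[i]≤j (≰⇒> (none i∈)) , proj₂ (maps-into (∈[a,b] (inj₂ i∈)))

module _ {w : ℤ → ℤ} {a b : ℤ}
         (maps-into : ∀ {i} → i ∈[ a , b ] → w i ∈[ a , b ])
         (injective : ∀ {i j} → i ∈[ a , b ] → j ∈[ a , b ] → w i ≡ w j → i ≡ j) where

  balanced-range : Balanced (_∈[ a , b ]) w
  balanced-range = rightBalanced-range maps-into injective ,
    leftBalanced-mirror (rightBalanced-⇔ -∈[a,b]⇒∈[-b,-a] ∈[-b,-a]⇒-∈[a,b]
      (rightBalanced-range mirror-maps-into mirror-injective))
    where
    mirror-maps-into : ∀ {i} → i ∈[ - b , - a ] → mirror w i ∈[ - b , - a ]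
    mirror-maps-into i∈ = neg-∈[] (maps-into (∈[-b,-a]⇒-∈[a,b] i∈))

    mirror-injective : ∀ {i j} → i ∈[ - b , - a ] → j ∈[ - b , - a ] → mirror w i ≡ mirror w j → i ≡ j
    mirror-injective i∈ j∈ eq = neg-injective
      (injective (∈[-b,-a]⇒-∈[a,b] i∈) (∈[-b,-a]⇒-∈[a,b] j∈) (neg-injective eq))

  crossing-in-range : ∀ {x} → x ∈[ a , b ] → w x ≢ x → CrossingIn (_∈[ a , b ]) w
  crossing-in-range = crossing-from-nonFixed (λ i∈ → ∣j-i∣≤∣b-a∣ i∈ (maps-into i∈)) balanced-range

-- Window sums and affine permutations

sumTo-cong : ∀ n {f g} → (∀ k → f (+ suc k) ≡ g (+ suc k)) → sumTo n f ≡ sumTo n g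
sumTo-cong zero    f≗g = refl
sumTo-cong (suc n) f≗g = cong₂ _+_ (sumTo-cong n f≗g) (f≗g n)

sumTo-+ : ∀ n f g → sumTo n (λ i → f i + g i) ≡ sumTo n f + sumTo n g
sumTo-+ zero    f g = refl
sumTo-+ (suc n) f g rewrite sumTo-+ n f g = +-interchange (sumTo n f) (sumTo n g) _ _
  where
  +-interchange : ∀ a b c d → a + b + (c + d) ≡ a + c + (b + d)
  +-interchange = solve-∀

sumTo-neg : ∀ n f → sumTo n (λ i → - f i) ≡ - sumTo n f
sumTo-neg zero    f = refl
sumTo-neg (suc n) f rewrite sumTo-neg n f = sym (neg-distrib-+ (sumTo n f) _)

sumTo-front : ∀ n f → sumTo (suc n) f ≡ f (+ 1) + sumTo n (λ i → f (+ 1 + i))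
sumTo-front zero    f = trans (+-identityˡ (f (+ 1))) (sym (+-identityʳ (f (+ 1))))
sumTo-front (suc n) f rewrite sumTo-front n f = +-assoc (f (+ 1)) _ _

sumTo-reverse : ∀ n f → sumTo n f ≡ sumTo n (λ i → f (+ 1 + + n - i))
sumTo-reverse zero    f = refl
sumTo-reverse (suc n) f = begin
  sumTo (suc n) f
    ≡⟨ sumTo-front n f ⟩
  f (+ 1) + sumTo n (λ i → f (+ 1 + i))
    ≡⟨ cong (λ s → f (+ 1) + s) (sumTo-reverse n (λ i → f (+ 1 + i))) ⟩
  f (+ 1) + sumTo n (λ i → f (+ 1 + (+ 1 + + n - i)))
    ≡⟨ cong₂ _+_ (cong f (one≡ (+ n))) (sumTo-cong n (λ k → cong f (reindex (+ n) (+ suc k)))) ⟩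
  f (+ 1 + (+ 1 + + n) - (+ 1 + + n)) + sumTo n (λ i → f (+ 1 + (+ 1 + + n) - i))
    ≡⟨ +-comm (f (+ 1 + (+ 1 + + n) - (+ 1 + + n))) _ ⟩
  sumTo (suc n) (λ i → f (+ 1 + (+ 1 + + n) - i)) ∎
  where
  open ≡-Reasoning
  one≡ : ∀ m → + 1 ≡ + 1 + (+ 1 + m) - (+ 1 + m)
  one≡ = solve-∀
  reindex : ∀ m i → + 1 + (+ 1 + m - i) ≡ + 1 + (+ 1 + m) - i
  reindex = solve-∀

window : ℕ → (ℤ → ℤ) → ℤ → ℤ
window P f c = sumTo P (λ i → f (c + i))

Periodic : ℕ → (ℤ → ℤ) → Set
Periodic P f = ∀ i → f (i + + P) ≡ f i

window-shift : ∀ P {f} → Periodic P f → ∀ c → window P f (c + + 1) ≡ window P f c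
window-shift zero     _        c = refl
window-shift (suc P′) {f} periodic c = begin
  sumTo P′ (λ i → f (c + + 1 + i)) + f (c + + 1 + + suc P′)
    ≡⟨ cong₂ _+_ (sumTo-cong P′ (λ k → cong f (+-assoc c (+ 1) (+ suc k)))) (periodic (c + + 1)) ⟩
  sumTo P′ (λ i → f (c + (+ 1 + i))) + f (c + + 1)
    ≡⟨ +-comm _ (f (c + + 1)) ⟩
  f (c + + 1) + sumTo P′ (λ i → f (c + (+ 1 + i)))
    ≡⟨ sumTo-front P′ (λ i → f (c + i)) ⟨
  window (suc P′) f c ∎
  where open ≡-Reasoning

window-independent : ∀ P {f} → Periodic P f → ∀ c → window P f c ≡ window P f (+ 0)
window-independent P periodic (+ zero)        = refl
window-independent P {f} periodic (+ suc m)   =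
  trans (cong (window P f) (cong +_ (ℕ.+-comm 1 m))) (trans (window-shift P periodic (+ m))
        (window-independent P periodic (+ m)))
window-independent P periodic -[1+ zero ]     = sym (window-shift P periodic -[1+ zero ])
window-independent P periodic -[1+ suc m ]    =
  trans (sym (window-shift P periodic -[1+ suc m ])) (window-independent P periodic -[1+ m ])

window-mirror : ∀ P f c → window P (λ i → - f (- i)) c ≡ - window P f (- c - + suc P)
window-mirror P f c = begin
  sumTo P (λ i → - f (- (c + i)))
    ≡⟨ sumTo-neg P (λ i → f (- (c + i))) ⟩
  - sumTo P (λ i → f (- (c + i)))
    ≡⟨ cong -_ (sumTo-reverse P (λ i → f (- (c + i)))) ⟩
  - sumTo P (λ i → f (- (c + (+ 1 + + P - i))))
    ≡⟨ cong -_ (sumTo-cong P (λ k → cong f (reflect c (+ P) (+ suc k)))) ⟩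
  - window P f (- c - + suc P) ∎
  where
  open ≡-Reasoning
  reflect : ∀ c p i → - (c + (+ 1 + p - i)) ≡ - c - (+ 1 + p) + i
  reflect = solve-∀

periodic-ℕ* : ∀ {P f} → Periodic P f → ∀ i m → f (i + + m * + P) ≡ f i
periodic-ℕ* {P} {f} periodic i zero    = cong f (+-identityʳ i)
periodic-ℕ* {P} {f} periodic i (suc m) = begin
  f (i + + suc m * + P)        ≡⟨ cong (λ t → f (i + t)) (suc-* (+ m) (+ P)) ⟩
  f (i + (+ P + + m * + P))    ≡⟨ cong f (regroup i (+ P) (+ m * + P)) ⟩
  f (i + + m * + P + + P)      ≡⟨ periodic (i + + m * + P) ⟩
  f (i + + m * + P)            ≡⟨ periodic-ℕ* periodic i m ⟩
  f i                          ∎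
  where
  open ≡-Reasoning
  regroup : ∀ i p t → i + (p + t) ≡ i + t + p
  regroup = solve-∀

periodic-* : ∀ {P f} → Periodic P f → ∀ i q → f (i + q * + P) ≡ f i
periodic-* periodic i (+ m)       = periodic-ℕ* periodic i m
periodic-* {P} {f} periodic i -[1+ m ] = sym (begin
  f i                                                ≡⟨ cong f (cancel i (+ suc m) (+ P)) ⟩
  f (i + -[1+ m ] * + P + + suc m * + P)             ≡⟨ periodic-ℕ* periodic _ (suc m) ⟩
  f (i + -[1+ m ] * + P)                             ∎)
  where
  open ≡-Reasoning
  cancel : ∀ i s p → i ≡ i + (- s) * p + s * p
  cancel = solve-∀

Equivariant : ℕ → (ℤ → ℤ) → Set
Equivariant P w = ∀ i → w (i + + P) ≡ w i + + P

displacement : (ℤ → ℤ) → ℤ → ℤ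
displacement w i = w i - i

displacement-periodic : ∀ {P w} → Equivariant P w → Periodic P (displacement w)
displacement-periodic {P} {w} equivariant i = begin
  w (i + + P) - (i + + P)   ≡⟨ cong (_- (i + + P)) (equivariant i) ⟩
  w i + + P - (i + + P)     ≡⟨ cancel (w i) i (+ P) ⟩
  w i - i                   ∎
  where
  open ≡-Reasoning
  cancel : ∀ a i p → a + p - (i + p) ≡ a - i
  cancel = solve-∀

equivariant-* : ∀ {P w} → Equivariant P w → ∀ i q → w (i + q * + P) ≡ w i + q * + P
equivariant-* {P} {w} equivariant i q = begin
  w (i + q * + P)                                          ≡⟨ split (w (i + q * + P)) (i + q * + P) ⟩
  displacement w (i + q * + P) + (i + q * + P)             ≡⟨ cong (_+ (i + q * + P))
                                                                (periodic-* (displacement-periodic {P} {w} equivariant) i q) ⟩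
  w i - i + (i + q * + P)                                  ≡⟨ merge (w i) i (q * + P) ⟩
  w i + q * + P                                            ∎
  where
  open ≡-Reasoning
  split : ∀ a j → a ≡ a - j + j
  split = solve-∀
  merge : ∀ a i t → a - i + (i + t) ≡ a + t
  merge = solve-∀

+∑≡sumTo : ∀ n f → + ∑< n f ≡ sumTo n (λ i → + f (ℕ.pred ∣ i ∣))
+∑≡sumTo zero    f = refl
+∑≡sumTo (suc n) f = trans (pos-+ (∑< n f) (f n)) (cong (_+ + f n) (+∑≡sumTo n f))

-- Injectivity and equivariance already force w to be a bijection of ℤ.
record IsAffinePermutation (P : ℕ) (w : ℤ → ℤ) : Set where
  field
    injective   : ∀ {i j} → w i ≡ w j → i ≡ j
    equivariant : Equivariant P w
    window-zero : window P (displacement w) (+ 0) ≡ + 0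

module AffinePermutation {P : ℕ} .{{_ : ℕ.NonZero P}} {w : ℤ → ℤ}
                         (isAffine : IsAffinePermutation P w) where
  open IsAffinePermutation isAffine

  private
    g = displacement w
    g-periodic = displacement-periodic {P} {w} equivariant

  window-zero-everywhere : ∀ c → window P g c ≡ + 0
  window-zero-everywhere c = trans (window-independent P g-periodic c) window-zero

  jumpBound : ℕ
  jumpBound = ∑[ k < P ] ∣ g (+ k) ∣

  bounded : ∀ i → ∣ w i - i ∣ ℕ.≤ jumpBound
  bounded i = subst (ℕ._≤ jumpBound) (cong ∣_∣ (sym g[i]≡g[r]))
                    (term≤∑ (λ k → ∣ g (+ k) ∣) (n%ℕd<d i P))
    where
    g[i]≡g[r] : g i ≡ g (+ (i %ℕ P))
    g[i]≡g[r] = trans (cong g (a≡a%ℕn+[a/ℕn]*n i P)) (periodic-* g-periodic (+ (i %ℕ P)) (i /ℕ P))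

  module _ (c : ℤ) where

    excess : ℤ → ℕ
    excess x = ∣ w x - ℤ.suc c ∣

    w≡c+suc[excess] : ∀ {x} → c < w x → w x ≡ c + + suc (excess x)
    w≡c+suc[excess] {x} c<wx = begin
      w x                            ≡⟨ split (w x) c ⟩
      c + (+ 1 + (w x - ℤ.suc c))   ≡⟨ cong (λ d → c + (+ 1 + d)) (0≤i⇒+∣i∣≡i (i≤j⇒0≤j-i (i<j⇒suc[i]≤j c<wx))) ⟨
      c + + suc (excess x)          ∎
      where
      open ≡-Reasoning
      split : ∀ a c → a ≡ c + (+ 1 + (a - (+ 1 + c)))
      split = solve-∀

    lowered : ℤ → ℤ
    lowered x = x - + (excess x / P ℕ.* P)

    w[lowered] : ∀ {x} → c < w x → w (lowered x) ≡ c + + suc (excess x % P)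
    w[lowered] {x} c<wx = begin
      w (x - + (q ℕ.* P))                         ≡⟨ cong w (as-multiple x q) ⟩
      w (x + - + q * + P)                         ≡⟨ equivariant-* {P} {w} equivariant x (- + q) ⟩
      w x + - + q * + P                           ≡⟨ cong (λ a → a + - + q * + P) (w≡c+suc[excess] c<wx) ⟩
      c + (+ 1 + + excess x) + - + q * + P        ≡⟨ cong (λ e → c + (+ 1 + e) + - + q * + P) +excess≡r+q*P ⟩
      c + (+ 1 + (+ r + + q * + P)) + - + q * + P ≡⟨ cancel c (+ r) (+ q) (+ P) ⟩
      c + + suc r                                 ∎
      where
      open ≡-Reasoning
      q = excess x / P
      r = excess x % P
      +excess≡r+q*P : + excess x ≡ + r + + q * + P
      +excess≡r+q*P = trans (cong +_ (m≡m%n+[m/n]*n (excess x) P))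
                            (trans (pos-+ r (q ℕ.* P)) (cong (λ t → + r + t) (pos-* q P)))
      as-multiple : ∀ x q → x - + (q ℕ.* P) ≡ x + - + q * + P
      as-multiple x q = cong (λ t → x + t) (trans (cong -_ (pos-* q P)) (neg-distribˡ-* (+ q) (+ P)))
      cancel : ∀ c r q p → c + (+ 1 + (r + q * p)) + - q * p ≡ c + (+ 1 + r)
      cancel = solve-∀

    -- If no element descends across the cut after c, the positions c+1, …, c+P have images
    -- above c, pairwise incongruent modulo P and with the same total as the positions (the
    -- window sum vanishes); so w maps this window into itself and leaves no room for the
    -- translated image of an element ascending across the cut.
    module _ (no-descent : ∀ {q} → c < q → c < w q) where

      private
        v : ℕ → ℕ
        v k = excess (c + + suc k)

        c<c+suc[k] : ∀ k → c < c + + suc k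
        c<c+suc[k] k = suc[i]≤j⇒i<j (proj₁ (c+suc[k]∈[suc[c],c+n] {c} {k} {suc k} ℕ.≤-refl))

      ∑excess≡∑id : ∑< P v ≡ ∑[ k < P ] k
      ∑excess≡∑id = +-injective (begin
        + ∑< P v                                         ≡⟨ +∑≡sumTo P v ⟩
        sumTo P (λ i → + v (ℕ.pred ∣ i ∣))               ≡⟨ sumTo-cong P +v≡g+k ⟩
        sumTo P (λ i → g (c + i) + + ℕ.pred ∣ i ∣)       ≡⟨ sumTo-+ P (λ i → g (c + i)) _ ⟩
        window P g c + sumTo P (λ i → + ℕ.pred ∣ i ∣)    ≡⟨ cong₂ _+_ (window-zero-everywhere c)
                                                                     (sym (+∑≡sumTo P (λ k → k))) ⟩
        + 0 + + ∑[ k < P ] k                             ≡⟨ +-identityˡ _ ⟩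
        + ∑[ k < P ] k                                   ∎)
        where
        open ≡-Reasoning
        +v≡g+k : ∀ k → + v k ≡ g (c + + suc k) + + k
        +v≡g+k k = trans (0≤i⇒+∣i∣≡i (i≤j⇒0≤j-i (i<j⇒suc[i]≤j (no-descent (c<c+suc[k] k)))))
                         (regroup (w (c + + suc k)) c (+ k))
          where regroup : ∀ a c k → a - (+ 1 + c) ≡ a - (c + (+ 1 + k)) + k
                regroup = solve-∀

      excess-residues-injective : InjectiveBelow P (λ k → v k % P)
      excess-residues-injective {i} {j} i<P j<P same-residue = begin
        i                          ≡⟨ m<n⇒m%n≡m i<P ⟨
        i % P                      ≡⟨ [m+kn]%n≡m%n i (v j / P) P ⟨
        (i ℕ.+ v j / P ℕ.* P) % P  ≡⟨ cong (_% P) (+-injective (trans (pos-+ i _) (trans cross (sym (pos-+ j _))))) ⟩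
        (j ℕ.+ v i / P ℕ.* P) % P  ≡⟨ [m+kn]%n≡m%n j (v i / P) P ⟩
        j % P                      ≡⟨ m<n⇒m%n≡m j<P ⟩
        j                          ∎
        where
        open ≡-Reasoning
        lowered-equal : lowered (c + + suc i) ≡ lowered (c + + suc j)
        lowered-equal = injective (trans (w[lowered] (no-descent (c<c+suc[k] i)))
          (trans (cong (λ r → c + + suc r) same-residue) (sym (w[lowered] (no-descent (c<c+suc[k] j))))))
        cross : + i + + (v j / P ℕ.* P) ≡ + j + + (v i / P ℕ.* P)
        cross = cross-multiply c (+ i) (+ j) (+ (v i / P ℕ.* P)) (+ (v j / P ℕ.* P)) lowered-equal
          where
          cross-multiply : ∀ c i j a b → c + (+ 1 + i) - a ≡ c + (+ 1 + j) - b → i + b ≡ j + a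
          cross-multiply c i j a b eq = begin
            i + b                                   ≡⟨ expand c i a b ⟩
            c + (+ 1 + i) - a + (a + b) - (c + + 1) ≡⟨ cong (λ t → t + (a + b) - (c + + 1)) eq ⟩
            c + (+ 1 + j) - b + (a + b) - (c + + 1) ≡⟨ contract c j a b ⟩
            j + a                                   ∎
            where
            expand : ∀ c i a b → i + b ≡ c + (+ 1 + i) - a + (a + b) - (c + + 1)
            expand = solve-∀
            contract : ∀ c j a b → c + (+ 1 + j) - b + (a + b) - (c + + 1) ≡ j + a
            contract = solve-∀

      window-closed : ∀ {i} → i ∈[ ℤ.suc c , c + + P ] → w i ∈[ ℤ.suc c , c + + P ]
      window-closed i∈ with k , k<P , refl ← ∈[suc[c],c+n]⇒offset {c} i∈ =
        subst (_∈[ ℤ.suc c , c + + P ]) (sym (w≡c+suc[excess] (no-descent (c<c+suc[k] k))))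
          (c+suc[k]∈[suc[c],c+n] {c} (bounded-by-distinct-residues P v excess-residues-injective ∑excess≡∑id k<P))

      no-ascent : ∀ {p} → p ≤ c → ¬ c < w p
      no-ascent {p} p≤c c<wp = no-injection-into-range lowered[p]<suc[c] maps-into (λ _ _ → injective)
        where
        lowered[p]<suc[c] : lowered p < ℤ.suc c
        lowered[p]<suc[c] = ≤-<-trans (i-j≤i p _) (≤-<-trans p≤c (suc[i]≤j⇒i<j ≤-refl))
        maps-into : ∀ {i} → i ≡ lowered p ⊎ i ∈[ ℤ.suc c , c + + P ] → w i ∈[ ℤ.suc c , c + + P ]
        maps-into (inj₁ refl) = subst (_∈[ ℤ.suc c , c + + P ]) (sym (w[lowered] c<wp))
                                      (c+suc[k]∈[suc[c],c+n] {c} (m%n<n _ P))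
        maps-into (inj₂ i∈)   = window-closed i∈

  rightBalanced : RightBalanced (λ _ → ⊤) w
  rightBalanced {c} {p} _ p≤c c<wp with search (λ q → w q ≤? c) (ℤ.suc c) (c + + jumpBound)
  ... | inj₁ (q , (c<q , _) , wq≤c) = q , tt , suc[i]≤j⇒i<j c<q , wq≤c
  ... | inj₂ none = ⊥-elim (no-ascent c no-descent p≤c c<wp)
    where
    no-descent : ∀ {q} → c < q → c < w q
    no-descent {q} c<q with q ≤? c + + jumpBound
    ... | yes q≤c+L = ≰⇒> (none (i<j⇒suc[i]≤j c<q , q≤c+L))
    ... | no  q≰c+L = <-≤-trans c<q-L q-L≤wq
      where
      c<q-L : c < q - + jumpBound
      c<q-L = subst (_< q - + jumpBound) (cancel c (+ jumpBound)) (+-monoˡ-< (- + jumpBound) (≰⇒> q≰c+L))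
        where cancel : ∀ c l → c + l - l ≡ c
              cancel = solve-∀
      q-L≤wq : q - + jumpBound ≤ w q
      q-L≤wq = subst (q - + jumpBound ≤_) (cancel q (w q))
                     (+-monoʳ-≤ q (proj₁ (∣i∣≤n⇒i∈[-n,n] (bounded q))))
        where cancel : ∀ q a → q + (a - q) ≡ a
              cancel = solve-∀

isAffine-mirror : ∀ {P w} → IsAffinePermutation P w → IsAffinePermutation P (mirror w)
isAffine-mirror {P} {w} isAffine = record
  { injective   = λ eq → neg-injective (injective (neg-injective eq))
  ; equivariant = mirror-equivariant
  ; window-zero = begin
      window P (displacement (mirror w)) (+ 0)
        ≡⟨ sumTo-cong P (λ k → mirror-displacement (w (- + suc k)) (+ suc k)) ⟩
      window P (λ i → - displacement w (- i)) (+ 0)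
        ≡⟨ window-mirror P (displacement w) (+ 0) ⟩
      - window P (displacement w) (- + 0 - + suc P)
        ≡⟨ cong -_ (trans (window-independent P (displacement-periodic {P} {w} equivariant) (- + 0 - + suc P)) window-zero) ⟩
      + 0 ∎
  }
  where
  open IsAffinePermutation isAffine
  open ≡-Reasoning
  mirror-displacement : ∀ a i → - a - i ≡ - (a - - i)
  mirror-displacement = solve-∀
  mirror-equivariant : Equivariant P (mirror w)
  mirror-equivariant i = begin
    - w (- (i + + P))              ≡⟨ cong (λ j → - w j) (back i (+ P)) ⟩
    - w (- i + - + 1 * + P)        ≡⟨ cong -_ (equivariant-* {P} {w} equivariant (- i) (- + 1)) ⟩
    - (w (- i) + - + 1 * + P)      ≡⟨ forth (w (- i)) (+ P) ⟩
    - w (- i) + + P                ∎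
    where
    back : ∀ i p → - (i + p) ≡ - i + - + 1 * p
    back = solve-∀
    forth : ∀ a p → - (a + - + 1 * p) ≡ - a + p
    forth = solve-∀

crossing-affinePermutation : ∀ {P} .{{_ : ℕ.NonZero P}} {w} → IsAffinePermutation P w →
  ¬ (∀ i → w i ≡ i) → CrossingIn (λ _ → ⊤) w
crossing-affinePermutation {P} {w} isAffine not-identity =
  let x , _ , wx≢x = nonFixed-in-range (λ fixes-window → not-identity (fixes-all fixes-window)) in
  crossing-from-nonFixed (λ {i} _ → bounded i)
    (rightBalanced , leftBalanced-mirror (AffinePermutation.rightBalanced (isAffine-mirror isAffine)))
    tt wx≢x
  where
  open AffinePermutation isAffine
  open IsAffinePermutation isAffine using (equivariant)
  fixes-all : (∀ {i} → i ∈[ + 0 , + P ] → w i ≡ i) → ∀ i → w i ≡ i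
  fixes-all fixes i = begin
    w i                                   ≡⟨ cong w (a≡a%ℕn+[a/ℕn]*n i P) ⟩
    w (+ (i %ℕ P) + i /ℕ P * + P)         ≡⟨ equivariant-* {P} {w} equivariant (+ (i %ℕ P)) (i /ℕ P) ⟩
    w (+ (i %ℕ P)) + i /ℕ P * + P         ≡⟨ cong (_+ i /ℕ P * + P) (fixes (ℤ.+≤+ ℕ.z≤n , ℤ.+≤+ (ℕ.<⇒≤ (n%ℕd<d i P)))) ⟩
    + (i %ℕ P) + i /ℕ P * + P             ≡⟨ a≡a%ℕn+[a/ℕn]*n i P ⟨
    i                                     ∎
    where open ≡-Reasoning

odd⇒window-zero : ∀ P {g} → Periodic P g → (∀ i → g (- i) ≡ - g i) → window P g (+ 0) ≡ + 0
odd⇒window-zero P {g} periodic odd = i≡-i⇒i≡0 (begin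
  window P g (+ 0)                       ≡⟨ sumTo-cong P (λ k → cong g (+-identityˡ (+ suc k))) ⟩
  sumTo P g                              ≡⟨ sumTo-cong P (λ k → trans (sym (neg-involutive _))
                                              (cong -_ (trans (sym (odd (+ suc k))) (cong g (sym (+-identityˡ _)))))) ⟩
  window P (λ i → - g (- i)) (+ 0)       ≡⟨ window-mirror P g (+ 0) ⟩
  - window P g (- + 0 - + suc P)         ≡⟨ cong -_ (window-independent P periodic (- + 0 - + suc P)) ⟩
  - window P g (+ 0)                     ∎)
  where open ≡-Reasoning

-- Exchanging residue classes

-- When S and S + d are disjoint, swap sends S to S + d and S + d back to S, fixing all else.
module SwapAlong {S : ℤ → Set} (S? : Decidable S) (d : ℤ) where

  shift : ℤ → ℤ
  shift i with S? i
  ... | yes _ = d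
  ... | no  _ = + 0

  swap : ℤ → ℤ
  swap i = i + shift i - shift (i - d)

  shift-∈ : ∀ {i} → S i → shift i ≡ d
  shift-∈ {i} i∈S with S? i
  ... | yes _   = refl
  ... | no  i∉S = ⊥-elim (i∉S i∈S)

  shift-∉ : ∀ {i} → ¬ S i → shift i ≡ + 0
  shift-∉ {i} i∉S with S? i
  ... | yes i∈S = ⊥-elim (i∉S i∈S)
  ... | no  _   = refl

  shift-cong : ∀ {i j} → (S i → S j) → (S j → S i) → shift i ≡ shift j
  shift-cong {i} {j} to from with S? i | S? j
  ... | yes _   | yes _   = refl
  ... | no  _   | no  _   = refl
  ... | yes i∈S | no  j∉S = ⊥-elim (j∉S (to i∈S))
  ... | no  i∉S | yes j∈S = ⊥-elim (i∉S (from j∈S))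

  private
    +d-d : ∀ i → i + d - d ≡ i
    +d-d i = +-d-d i d
      where +-d-d : ∀ i d → i + d - d ≡ i
            +-d-d = solve-∀

    -d+d : ∀ i → i - d + d ≡ i
    -d+d i = -d+d′ i d
      where -d+d′ : ∀ i d → i - d + d ≡ i
            -d+d′ = solve-∀

  swap-outside : ∀ {i} → ¬ S i → ¬ S (i - d) → swap i ≡ i
  swap-outside {i} i∉S i-d∉S =
    trans (cong₂ (λ a b → i + a - b) (shift-∉ i∉S) (shift-∉ i-d∉S)) (trans (+-identityʳ _) (+-identityʳ i))

  swap-equivariant : ∀ M → (∀ {i} → S (i + + M) → S i) → (∀ {i} → S i → S (i + + M)) →
    Equivariant M swap
  swap-equivariant M down up i = begin
    i + + M + shift (i + + M) - shift (i + + M - d)   ≡⟨ cong₂ (λ a b → i + + M + a - b)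
                                                          (shift-cong down up) (trans (cong shift (comm i (+ M) d))
                                                          (shift-cong down up)) ⟩
    i + + M + shift i - shift (i - d)                 ≡⟨ regroup i (+ M) (shift i) (shift (i - d)) ⟩
    swap i + + M                                      ∎
    where
    open ≡-Reasoning
    comm : ∀ i m d → i + m - d ≡ i - d + m
    comm = solve-∀
    regroup : ∀ i m a b → i + m + a - b ≡ i + a - b + m
    regroup = solve-∀

  swap-odd : (∀ {i} → S (- i) → S (i - d)) → (∀ {i} → S (i - d) → S (- i)) →
    ∀ i → swap (- i) ≡ - swap i
  swap-odd to from i = begin
    - i + shift (- i) - shift (- i - d)     ≡⟨ cong₂ (λ a b → - i + a - b) (shift-cong to from) shift[-i-d]≡shift[i] ⟩
    - i + shift (i - d) - shift i           ≡⟨ negate i (shift i) (shift (i - d)) ⟩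
    - (i + shift i - shift (i - d))         ∎
    where
    open ≡-Reasoning
    negate : ∀ i a b → - i + b - a ≡ - (i + a - b)
    negate = solve-∀
    -i-d≡-[i+d] : ∀ i d → - i - d ≡ - (i + d)
    -i-d≡-[i+d] = solve-∀
    shift[-i-d]≡shift[i] : shift (- i - d) ≡ shift i
    shift[-i-d]≡shift[i] = trans (cong shift (-i-d≡-[i+d] i d))
      (trans (shift-cong to from) (cong shift (+d-d i)))

  swap-sumTo : ∀ P → (∀ {i} → S (i + + P) → S i) → (∀ {i} → S i → S (i + + P)) →
    sumTo P swap ≡ sumTo P (λ i → i)
  swap-sumTo P down up = begin
    sumTo P swap
      ≡⟨ sumTo-cong P (λ k → regroup (+ suc k) (shift (+ suc k)) (shift (+ suc k - d))) ⟩
    sumTo P (λ i → i + (shift i + - shift (i - d)))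
      ≡⟨ sumTo-+ P (λ i → i) _ ⟩
    sumTo P (λ i → i) + sumTo P (λ i → shift i + - shift (i - d))
      ≡⟨ cong (λ t → sumTo P (λ i → i) + t) (trans (sumTo-+ P shift _) (cong (λ t → sumTo P shift + t) (sumTo-neg P _))) ⟩
    sumTo P (λ i → i) + (sumTo P shift + - sumTo P (λ i → shift (i - d)))
      ≡⟨ cong (λ t → sumTo P (λ i → i) + t) (cong₂ (λ a b → a + - b)
           (sumTo-cong P (λ k → cong shift (sym (+-identityˡ (+ suc k)))))
           (sumTo-cong P (λ k → cong shift (+-comm (+ suc k) (- d))))) ⟩
    sumTo P (λ i → i) + (window P shift (+ 0) + - window P shift (- d))
      ≡⟨ cong (λ t → sumTo P (λ i → i) + (window P shift (+ 0) + - t))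
              (window-independent P (λ i → shift-cong {i + + P} {i} down up) (- d)) ⟩
    sumTo P (λ i → i) + (window P shift (+ 0) + - window P shift (+ 0))
      ≡⟨ cong (λ t → sumTo P (λ i → i) + t) (+-inverseʳ (window P shift (+ 0))) ⟩
    sumTo P (λ i → i) + + 0
      ≡⟨ +-identityʳ _ ⟩
    sumTo P (λ i → i) ∎
    where
    open ≡-Reasoning
    regroup : ∀ i a b → i + a - b ≡ i + (a + - b)
    regroup = solve-∀

  module _ (disjoint : ∀ {i} → S i → ¬ S (i - d)) where

    swap-∈ : ∀ {i} → S i → swap i ≡ i + d
    swap-∈ {i} i∈S = trans (cong₂ (λ a b → i + a - b) (shift-∈ i∈S) (shift-∉ (disjoint i∈S)))
                           (+-identityʳ (i + d))

    swap-∈+d : ∀ {i} → S (i - d) → swap i ≡ i - d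
    swap-∈+d {i} i-d∈S = trans (cong₂ (λ a b → i + a - b) (shift-∉ (λ i∈S → disjoint i∈S i-d∈S)) (shift-∈ i-d∈S))
                               (cong (_- d) (+-identityʳ i))

    swap-cases : ∀ i → swap i ≡ i ⊎ (S i × swap i ≡ i + d) ⊎ (S (i - d) × swap i ≡ i - d)
    swap-cases i = by-cases (S? i) (S? (i - d))
      where
      by-cases : Dec (S i) → Dec (S (i - d)) →
        swap i ≡ i ⊎ (S i × swap i ≡ i + d) ⊎ (S (i - d) × swap i ≡ i - d)
      by-cases (yes i∈S) _           = inj₂ (inj₁ (i∈S , swap-∈ {i} i∈S))
      by-cases (no  _)   (yes i-d∈S) = inj₂ (inj₂ (i-d∈S , swap-∈+d {i} i-d∈S))
      by-cases (no  i∉S) (no  i-d∉S) = inj₁ (swap-outside i∉S i-d∉S)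

    swap-exchanges : ∀ {x} → S x → swap x ≡ x + d × swap (x + d) ≡ x
    swap-exchanges {x} x∈S = swap-∈ x∈S , trans (swap-∈+d {x + d} (subst S (sym (+d-d x)) x∈S)) (+d-d x)

    swap-involutive : ∀ i → swap (swap i) ≡ i
    swap-involutive i with swap-cases i
    ... | inj₁ swap[i]≡i                    = trans (cong swap swap[i]≡i) swap[i]≡i
    ... | inj₂ (inj₁ (i∈S , swap[i]≡i+d))   = trans (cong swap swap[i]≡i+d) (proj₂ (swap-exchanges i∈S))
    ... | inj₂ (inj₂ (i-d∈S , swap[i]≡i-d)) =
      trans (cong swap swap[i]≡i-d) (trans (proj₁ (swap-exchanges i-d∈S)) (-d+d i))

-- Modulo 0 congruence is equality, so the finite groups are the case M = 0.
infix 4 _≡_mod_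
record _≡_mod_ (i x : ℤ) (M : ℕ) : Set where
  constructor congruent
  field divides-difference : + M ∣ i - x

_≡?_mod_ : ∀ i x M → Dec (i ≡ x mod M)
i ≡? x mod M = map′ congruent _≡_mod_.divides-difference (+ M ∣? i - x)

x+[y-x]≡y : ∀ x y → x + (y - x) ≡ y
x+[y-x]≡y = solve-∀

≡mod-refl : ∀ {M} x → x ≡ x mod M
≡mod-refl x = congruent (divides (+ 0) (+-inverseʳ x))

≡mod0⇒≡ : ∀ {x i} → i ≡ x mod 0 → i ≡ x
≡mod0⇒≡ {x} {i} (congruent (divides q i-x≡q*0)) = i-j≡0⇒i≡j i x (trans i-x≡q*0 (*-zeroʳ q))

≡mod-difference : ∀ {M a b s t c r} → a ≡ s mod M → b ≡ t mod M →
  a - s - (b - t) ≡ c - r → c ≡ r mod M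
≡mod-difference (congruent M∣a-s) (congruent M∣b-t) eq =
  congruent (subst (_ ∣_) eq (∣m∣n⇒∣m-n M∣a-s M∣b-t))

≡mod-negate : ∀ {M a s c r} → a ≡ s mod M → - (a - s) ≡ c - r → c ≡ r mod M
≡mod-negate (congruent M∣a-s) eq = congruent (subst (_ ∣_) eq (∣m⇒∣-m M∣a-s))

≡mod-up : ∀ {M x i} → i ≡ x mod M → i + + M ≡ x mod M
≡mod-up {M} {x} {i} (congruent M∣i-x) =
  congruent (subst (+ M ∣_) (shift i x (+ M)) (∣m∣n⇒∣m+n M∣i-x ∣-refl))
  where shift : ∀ i x m → i - x + m ≡ i + m - x
        shift = solve-∀

≡mod-down : ∀ {M x i} → i + + M ≡ x mod M → i ≡ x mod M
≡mod-down {M} {x} {i} (congruent M∣i+M-x) =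
  congruent (∣m+n∣n⇒∣m (subst (+ M ∣_) (shift i x (+ M)) M∣i+M-x) ∣-refl)
  where shift : ∀ i x m → i + m - x ≡ i - x + m
        shift = solve-∀

equivariant-zero : ∀ w → Equivariant 0 w
equivariant-zero w i = trans (cong w (+-identityʳ i)) (sym (+-identityʳ (w i)))

crossing-not-congruent : ∀ {M w x y} → Equivariant M w → Crossing w x y → ¬ y ≡ x mod M
crossing-not-congruent {M} {w} {x} {y} equivariant (y≤wx , x<y , wy≤x) (congruent (divides q y-x≡q*M)) =
  <-irrefl g[y]≡g[x] (<-trans g[y]<0 0<g[x])
  where
  g = displacement w
  g[y]≡g[x] : g y ≡ g x
  g[y]≡g[x] = trans (cong g (trans (sym (x+[y-x]≡y x y)) (cong (λ t → x + t) y-x≡q*M)))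
                    (periodic-* (displacement-periodic {M} {w} equivariant) x q)
  0<g[x] : + 0 < g x
  0<g[x] = subst (_< g x) (+-inverseʳ x) (+-monoˡ-< (- x) (<-≤-trans x<y y≤wx))
  g[y]<0 : g y < + 0
  g[y]<0 = subst (g y <_) (+-inverseʳ y) (+-monoˡ-< (- y) (≤-<-trans wy≤x x<y))

self-opposite⇒fixed : ∀ {M w z} → Equivariant M w → w (- z) ≡ - w z → - z ≡ z mod M → w z ≡ z
self-opposite⇒fixed {M} {w} {z} equivariant odd-at-z (congruent (divides q -z-z≡q*M)) =
  i-j≡0⇒i≡j (w z) z (i≡-i⇒i≡0 g[z]≡-g[z])
  where
  g = displacement w
  g[z]≡-g[z] : g z ≡ - g z
  g[z]≡-g[z] = begin
    g z                  ≡⟨ periodic-* (displacement-periodic {M} {w} equivariant) z q ⟨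
    g (z + q * + M)      ≡⟨ cong g (trans (cong (λ t → z + t) (sym -z-z≡q*M)) (z+[-z-z]≡-z z)) ⟩
    w (- z) - - z        ≡⟨ cong (_- - z) odd-at-z ⟩
    - w z - - z          ≡⟨ negate (w z) z ⟩
    - g z                ∎
    where
    open ≡-Reasoning
    z+[-z-z]≡-z : ∀ z → z + (- z - z) ≡ - z
    z+[-z-z]≡-z = solve-∀
    negate : ∀ a z → - a - - z ≡ - (a - z)
    negate = solve-∀

module PlainSwap (M : ℕ) {x y : ℤ} (y≢x : ¬ y ≡ x mod M) where
  open SwapAlong (λ i → i ≡? x mod M) (y - x) public

  disjoint : ∀ {i} → i ≡ x mod M → ¬ i - (y - x) ≡ x mod M
  disjoint {i} i≡x i-d≡x = y≢x (≡mod-difference i≡x i-d≡x (difference i x y))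
    where difference : ∀ i x y → i - x - (i - (y - x) - x) ≡ y - x
          difference = solve-∀

  swap-x : swap x ≡ y
  swap-x = trans (proj₁ (swap-exchanges disjoint (≡mod-refl x))) (x+[y-x]≡y x y)

  swap-y : swap y ≡ x
  swap-y = trans (cong swap (sym (x+[y-x]≡y x y))) (proj₂ (swap-exchanges disjoint (≡mod-refl x)))

  involutive : ∀ i → swap (swap i) ≡ i
  involutive = swap-involutive disjoint

  equivariant : Equivariant M swap
  equivariant = swap-equivariant M ≡mod-down ≡mod-up

  cases : ∀ i → swap i ≡ i ⊎ (i ≡ x mod M × swap i ≡ i + (y - x)) ⊎
                              (i - (y - x) ≡ x mod M × swap i ≡ i - (y - x))
  cases = swap-cases disjoint

module SignedSwap (M : ℕ) {x y : ℤ}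
                  (y≢x : ¬ y ≡ x mod M) (-x≢x : ¬ - x ≡ x mod M) (-y≢y : ¬ - y ≡ y mod M) where

  Orbit : ℤ → Set
  Orbit i = i ≡ x mod M ⊎ i ≡ - y mod M

  open SwapAlong (λ i → (i ≡? x mod M) ⊎-dec (i ≡? - y mod M)) (y - x) public

  disjoint : ∀ {i} → Orbit i → ¬ Orbit (i - (y - x))
  disjoint {i} (inj₁ i≡x)  (inj₁ i-d≡x)  = y≢x  (≡mod-difference i≡x i-d≡x (difference i x y))
    where difference : ∀ i x y → i - x - (i - (y - x) - x) ≡ y - x
          difference = solve-∀
  disjoint {i} (inj₁ i≡x)  (inj₂ i-d≡-y) = -x≢x (≡mod-difference i≡x i-d≡-y (difference i x y))
    where difference : ∀ i x y → i - x - (i - (y - x) - - y) ≡ - x - x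
          difference = solve-∀
  disjoint {i} (inj₂ i≡-y) (inj₁ i-d≡x)  = -y≢y (≡mod-difference i-d≡x i≡-y (difference i x y))
    where difference : ∀ i x y → i - (y - x) - x - (i - - y) ≡ - y - y
          difference = solve-∀
  disjoint {i} (inj₂ i≡-y) (inj₂ i-d≡-y) = y≢x  (≡mod-difference i≡-y i-d≡-y (difference i x y))
    where difference : ∀ i x y → i - - y - (i - (y - x) - - y) ≡ y - x
          difference = solve-∀

  swap-x : swap x ≡ y
  swap-x = trans (proj₁ (swap-exchanges disjoint (inj₁ (≡mod-refl x)))) (x+[y-x]≡y x y)

  swap-y : swap y ≡ x
  swap-y = trans (cong swap (sym (x+[y-x]≡y x y)))
                 (proj₂ (swap-exchanges disjoint (inj₁ (≡mod-refl x))))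

  involutive : ∀ i → swap (swap i) ≡ i
  involutive = swap-involutive disjoint

  equivariant : Equivariant M swap
  equivariant = swap-equivariant M (Sum.map ≡mod-down ≡mod-down) (Sum.map ≡mod-up ≡mod-up)

  odd : ∀ i → swap (- i) ≡ - swap i
  odd = swap-odd reflect reflect′
    where
    reflect : ∀ {i} → Orbit (- i) → Orbit (i - (y - x))
    reflect {i} (inj₁ -i≡x)  = inj₂ (≡mod-negate -i≡x (difference i x y))
      where difference : ∀ i x y → - (- i - x) ≡ i - (y - x) - - y
            difference = solve-∀
    reflect {i} (inj₂ -i≡-y) = inj₁ (≡mod-negate -i≡-y (difference i x y))
      where difference : ∀ i x y → - (- i - - y) ≡ i - (y - x) - x
            difference = solve-∀
    reflect′ : ∀ {i} → Orbit (i - (y - x)) → Orbit (- i)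
    reflect′ {i} (inj₁ i-d≡x)  = inj₂ (≡mod-negate i-d≡x (difference i x y))
      where difference : ∀ i x y → - (i - (y - x) - x) ≡ - i - - y
            difference = solve-∀
    reflect′ {i} (inj₂ i-d≡-y) = inj₁ (≡mod-negate i-d≡-y (difference i x y))
      where difference : ∀ i x y → - (i - (y - x) - - y) ≡ - i - x
            difference = solve-∀

  cases : ∀ i → swap i ≡ i ⊎ (Orbit i × swap i ≡ i + (y - x)) ⊎
                              (Orbit (i - (y - x)) × swap i ≡ i - (y - x))
  cases = swap-cases disjoint

-- The four groups

involution⇒BijOn : ∀ {D : ℤ → Set} {u} → (∀ i → D i → D (u i)) → (∀ i → u (u i) ≡ i) → BijOn D u
involution⇒BijOn {u = u} maps-into involutive =
  maps-into ,
  (λ i j _ _ u[i]≡u[j] → trans (sym (involutive i)) (trans (cong u u[i]≡u[j]) (involutive j))) ,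
  (λ j j∈D → u j , maps-into j j∈D , involutive j)

sumTo-id : ∀ n → sumTo n (λ i → i) ≡ + (suc n C 2)
sumTo-id zero    = refl
sumTo-id (suc n) = begin
  sumTo n (λ i → i) + + suc n          ≡⟨ cong (_+ + suc n) (sumTo-id n) ⟩
  + (suc n C 2) + + suc n              ≡⟨ pos-+ (suc n C 2) (suc n) ⟨
  + (suc n C 2 ℕ.+ suc n)              ≡⟨ cong +_ (ℕ.+-comm (suc n C 2) (suc n)) ⟩
  + (suc n ℕ.+ suc n C 2)              ≡⟨ cong (λ m → + (m ℕ.+ suc n C 2)) (nC1≡n (suc n)) ⟨
  + (suc n C 1 ℕ.+ suc n C 2)          ≡⟨ cong +_ (nCk+nC[k+1]≡[n+1]C[k+1] (suc n) 1) ⟩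
  + (suc (suc n) C 2)                  ∎
  where open ≡-Reasoning

crossing-typeA : ∀ {n w} → InW typeA n w → ¬ IsIdentity typeA n w → CrossingIn (Dom typeA n) w
crossing-typeA (maps-into , injective , _) w≢id =
  let x , x∈ , wx≢x = nonFixed-in-range (λ fixes → w≢id (λ _ → fixes)) in
  crossing-in-range (maps-into _) (injective _ _) x∈ wx≢x

transposable-typeA : ∀ {n w x y} → Dom typeA n x → Dom typeA n y → Crossing w x y → Transposable typeA n x y
transposable-typeA {n} {w} {x} {y} x∈ y∈ crossing@(_ , x<y , _) =
  x∈ , y∈ , <⇒≢ x<y , swap , involution⇒BijOn preserves involutive , swap-x , swap-y
  where
  open PlainSwap 0 (crossing-not-congruent (equivariant-zero w) crossing)
  preserves : ∀ i → Dom typeA n i → Dom typeA n (swap i)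
  preserves i i∈ with cases i
  ... | inj₁ swap[i]≡i = subst (Dom typeA n) (sym swap[i]≡i) i∈
  ... | inj₂ (inj₁ (i≡x , swap[i]≡i+d)) = subst (Dom typeA n)
          (sym (trans swap[i]≡i+d (trans (cong (_+ (y - x)) (≡mod0⇒≡ i≡x)) (x+[y-x]≡y x y)))) y∈
  ... | inj₂ (inj₂ (i-d≡x , swap[i]≡i-d)) = subst (Dom typeA n) (sym (trans swap[i]≡i-d (≡mod0⇒≡ i-d≡x))) x∈

i∈[-n,n]⇒∣i∣≤n : ∀ {i n} → i ∈[ - + n , + n ] → ∣ i ∣ ℕ.≤ n
i∈[-n,n]⇒∣i∣≤n {+ m}      (_ , m≤n)    = drop‿+≤+ m≤n
i∈[-n,n]⇒∣i∣≤n { -[1+ m ]} (-n≤-1-m , _) = drop‿+≤+ (neg-cancel-≤ -n≤-1-m)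

i≢0⇒1≤∣i∣ : ∀ {i} → i ≢ + 0 → 1 ℕ.≤ ∣ i ∣
i≢0⇒1≤∣i∣ {+ zero}   i≢0 = ⊥-elim (i≢0 refl)
i≢0⇒1≤∣i∣ {+ suc _}  _   = ℕ.s≤s ℕ.z≤n
i≢0⇒1≤∣i∣ { -[1+ _ ]} _   = ℕ.s≤s ℕ.z≤n

1≤∣i∣⇒i≢0 : ∀ {i} → 1 ℕ.≤ ∣ i ∣ → i ≢ + 0
1≤∣i∣⇒i≢0 () refl

±[n]⇒[-n,n] : ∀ {n i} → Dom typeB n i → i ∈[ - + n , + n ]
±[n]⇒[-n,n] (_ , ∣i∣≤n) = ∣i∣≤n⇒i∈[-n,n] ∣i∣≤n

[-n,n]⇒±[n] : ∀ {n i} → i ∈[ - + n , + n ] → i ≢ + 0 → Dom typeB n i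
[-n,n]⇒±[n] i∈ i≢0 = i≢0⇒1≤∣i∣ i≢0 , i∈[-n,n]⇒∣i∣≤n i∈

±[n]-neg : ∀ {n i} → Dom typeB n i → Dom typeB n (- i)
±[n]-neg {i = i} = subst (λ m → 1 ℕ.≤ m × m ℕ.≤ _) (sym (∣-i∣≡∣i∣ i))

-- On the interval [-n, n] an element of S^B_n becomes an injection once 0 is sent to 0.
fixing-zero : (ℤ → ℤ) → ℤ → ℤ
fixing-zero w i with i ≟ + 0
... | yes _ = + 0
... | no  _ = w i

fixing-zero-≢0 : ∀ w {i} → i ≢ + 0 → fixing-zero w i ≡ w i
fixing-zero-≢0 w {i} i≢0 with i ≟ + 0
... | yes i≡0 = ⊥-elim (i≢0 i≡0)
... | no  _   = refl

crossing-typeB : ∀ {n w} → InW typeB n w → ¬ IsIdentity typeB n w → CrossingIn (Dom typeB n) w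
crossing-typeB {n} {w} ((maps-into , injective , _) , _) w≢id =
  let x₀ , x₀∈ , w₀x₀≢x₀ = nonFixed-in-range fixes-±[n] in
  restrict (crossing-in-range w₀-maps-into w₀-injective x₀∈ w₀x₀≢x₀)
  where
  w₀ = fixing-zero w

  moved⇒≢0 : ∀ {i} → w₀ i ≢ i → i ≢ + 0
  moved⇒≢0 w₀i≢i refl = w₀i≢i refl

  fixes-±[n] : (∀ {i} → i ∈[ - + n , + n ] → w₀ i ≡ i) → ⊥
  fixes-±[n] fixes = w≢id λ i i∈ → trans (sym (fixing-zero-≢0 w (1≤∣i∣⇒i≢0 (proj₁ i∈)))) (fixes (±[n]⇒[-n,n] i∈))

  w₀-maps-into : ∀ {i} → i ∈[ - + n , + n ] → w₀ i ∈[ - + n , + n ]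
  w₀-maps-into {i} i∈ with i ≟ + 0
  ... | yes _   = ∣i∣≤n⇒i∈[-n,n] ℕ.z≤n
  ... | no  i≢0 = ±[n]⇒[-n,n] (maps-into i ([-n,n]⇒±[n] i∈ i≢0))

  w₀-injective : ∀ {i j} → i ∈[ - + n , + n ] → j ∈[ - + n , + n ] → w₀ i ≡ w₀ j → i ≡ j
  w₀-injective {i} {j} i∈ j∈ w₀i≡w₀j = by-cases (i ≟ + 0) (j ≟ + 0)
    where
    w≢0 : ∀ {k} → k ∈[ - + n , + n ] → k ≢ + 0 → w k ≢ + 0
    w≢0 k∈ k≢0 = 1≤∣i∣⇒i≢0 (proj₁ (maps-into _ ([-n,n]⇒±[n] k∈ k≢0)))
    by-cases : Dec (i ≡ + 0) → Dec (j ≡ + 0) → i ≡ j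
    by-cases (yes i≡0) (yes j≡0) = trans i≡0 (sym j≡0)
    by-cases (yes refl) (no j≢0) = ⊥-elim (w≢0 j∈ j≢0 (trans (sym (fixing-zero-≢0 w j≢0)) (sym w₀i≡w₀j)))
    by-cases (no i≢0) (yes refl) = ⊥-elim (w≢0 i∈ i≢0 (trans (sym (fixing-zero-≢0 w i≢0)) w₀i≡w₀j))
    by-cases (no i≢0) (no j≢0)   = injective i j ([-n,n]⇒±[n] i∈ i≢0) ([-n,n]⇒±[n] j∈ j≢0)
      (trans (sym (fixing-zero-≢0 w i≢0)) (trans w₀i≡w₀j (fixing-zero-≢0 w j≢0)))

  restrict : CrossingIn (_∈[ - + n , + n ]) w₀ → CrossingIn (Dom typeB n) w
  restrict (x , y , x∈ , y∈ , crossing@(y≤w₀x , x<y , w₀y≤x)) =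
    x , y , [-n,n]⇒±[n] x∈ x≢0 , [-n,n]⇒±[n] y∈ y≢0 ,
    subst (y ≤_) (fixing-zero-≢0 w x≢0) y≤w₀x , x<y , subst (_≤ x) (fixing-zero-≢0 w y≢0) w₀y≤x
    where
    x≢0 = moved⇒≢0 (crossing-moves-left crossing)
    y≢0 = moved⇒≢0 (crossing-moves-right crossing)

transposable-typeB : ∀ {n w x y} → InW typeB n w → Dom typeB n x → Dom typeB n y → Crossing w x y →
  Transposable typeB n x y
transposable-typeB {n} {w} {x} {y} (_ , odd-on-±[n]) x∈ y∈ crossing@(_ , x<y , _) =
  x∈ , y∈ , <⇒≢ x<y , swap , (involution⇒BijOn preserves involutive , λ i _ → odd i) , swap-x , swap-y
  where
  not-self-opposite : ∀ {z} → Dom typeB n z → w z ≢ z → ¬ - z ≡ z mod 0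
  not-self-opposite {z} z∈ moves = moves ∘ self-opposite⇒fixed (equivariant-zero w) (odd-on-±[n] z z∈)
  open SignedSwap 0 (crossing-not-congruent (equivariant-zero w) crossing)
                    (not-self-opposite x∈ (crossing-moves-left crossing))
                    (not-self-opposite y∈ (crossing-moves-right crossing))
  D = Dom typeB n
  preserves : ∀ i → D i → D (swap i)
  preserves i i∈ with cases i
  ... | inj₁ swap[i]≡i = subst D (sym swap[i]≡i) i∈
  ... | inj₂ (inj₁ (inj₁ i≡x , swap[i]≡i+d)) = subst D
          (sym (trans swap[i]≡i+d (trans (cong (_+ (y - x)) (≡mod0⇒≡ i≡x)) (x+[y-x]≡y x y)))) y∈
  ... | inj₂ (inj₁ (inj₂ i≡-y , swap[i]≡i+d)) = subst D
          (sym (trans swap[i]≡i+d (trans (cong (_+ (y - x)) (≡mod0⇒≡ i≡-y)) (-y+[y-x]≡-x x y)))) (±[n]-neg {i = x} x∈)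
    where -y+[y-x]≡-x : ∀ x y → - y + (y - x) ≡ - x
          -y+[y-x]≡-x = solve-∀
  ... | inj₂ (inj₂ (inj₁ i-d≡x , swap[i]≡i-d))  = subst D (sym (trans swap[i]≡i-d (≡mod0⇒≡ i-d≡x))) x∈
  ... | inj₂ (inj₂ (inj₂ i-d≡-y , swap[i]≡i-d)) = subst D (sym (trans swap[i]≡i-d (≡mod0⇒≡ i-d≡-y))) (±[n]-neg {i = y} y∈)

window-zero-from-sum : ∀ n {w} → sumTo n w ≡ sumTo n (λ i → i) → window n (displacement w) (+ 0) ≡ + 0
window-zero-from-sum n {w} sum≡sum = begin
  window n (displacement w) (+ 0)          ≡⟨ sumTo-cong n (λ k → cong (λ i → w i - i) (+-identityˡ (+ suc k))) ⟩
  sumTo n (λ i → w i + - i)               ≡⟨ sumTo-+ n w (λ i → - i) ⟩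
  sumTo n w + sumTo n (λ i → - i)         ≡⟨ cong₂ (λ a b → a + b) sum≡sum (sumTo-neg n (λ i → i)) ⟩
  sumTo n (λ i → i) - sumTo n (λ i → i)   ≡⟨ +-inverseʳ (sumTo n (λ i → i)) ⟩
  + 0                                      ∎
  where open ≡-Reasoning

crossing-affineA : ∀ {n w} .{{_ : ℕ.NonZero n}} → InW affineA n w → ¬ IsIdentity affineA n w →
  CrossingIn (Dom affineA n) w
crossing-affineA {n} {w} ((_ , injective , _) , equivariant , sum≡C) w≢id =
  crossing-affinePermutation isAffine (λ fixes → w≢id (λ i _ → fixes i))
  where
  isAffine : IsAffinePermutation n w
  isAffine = record
    { injective   = injective _ _ tt tt
    ; equivariant = equivariant
    ; window-zero = window-zero-from-sum n (trans sum≡C (sym (sumTo-id n)))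
    }

transposable-affineA : ∀ {n w x y} → InW affineA n w → Crossing w x y → Transposable affineA n x y
transposable-affineA {n} {w} {x} {y} (_ , w-equivariant , _) crossing@(_ , x<y , _) =
  tt , tt , <⇒≢ x<y , swap ,
  (involution⇒BijOn (λ _ _ → tt) involutive , equivariant , trans (swap-sumTo n ≡mod-down ≡mod-up) (sumTo-id n)) ,
  swap-x , swap-y
  where open PlainSwap n (crossing-not-congruent w-equivariant crossing)

crossing-affineC : ∀ {n w} → InW affineC n w → ¬ IsIdentity affineC n w → CrossingIn (Dom affineC n) w
crossing-affineC {n} {w} ((_ , injective , _) , odd , equivariant) w≢id =
  crossing-affinePermutation isAffine (λ fixes → w≢id (λ i _ → fixes i))
  where
  instance
    period≢0 : ℕ.NonZero (2 ℕ.* n ℕ.+ 2)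
    period≢0 = ℕ.>-nonZero (ℕ.<-≤-trans (ℕ.s≤s ℕ.z≤n) (ℕ.m≤n+m 2 (2 ℕ.* n)))
  isAffine : IsAffinePermutation (2 ℕ.* n ℕ.+ 2) w
  isAffine = record
    { injective   = injective _ _ tt tt
    ; equivariant = equivariant
    ; window-zero = odd⇒window-zero (2 ℕ.* n ℕ.+ 2) (displacement-periodic {2 ℕ.* n ℕ.+ 2} {w} equivariant)
                      (λ i → trans (cong (_- - i) (odd i)) (negate (w i) i))
    }
    where negate : ∀ a i → - a - - i ≡ - (a - i)
          negate = solve-∀

transposable-affineC : ∀ {n w x y} → InW affineC n w → Crossing w x y → Transposable affineC n x y
transposable-affineC {n} {w} {x} {y} (_ , w-odd , w-equivariant) crossing@(_ , x<y , _) =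
  tt , tt , <⇒≢ x<y , swap , (involution⇒BijOn (λ _ _ → tt) involutive , odd , equivariant) , swap-x , swap-y
  where
  open SignedSwap (2 ℕ.* n ℕ.+ 2) (crossing-not-congruent w-equivariant crossing)
    (crossing-moves-left crossing ∘ self-opposite⇒fixed w-equivariant (w-odd x))
    (crossing-moves-right crossing ∘ self-opposite⇒fixed w-equivariant (w-odd y))

crossing : ∀ W n {w} → 1 ℕ.≤ n → InW W n w → ¬ IsIdentity W n w → CrossingIn (Dom W n) w
crossing typeA   n       _ = crossing-typeA
crossing typeB   n       _ = crossing-typeB
crossing affineA zero    ()
crossing affineA (suc n) _ = crossing-affineA
crossing affineC n       _ = crossing-affineC {n}

transposable : ∀ W n {w x y} → InW W n w → Dom W n x → Dom W n y → Crossing w x y → Transposable W n x y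
transposable typeA   n _   x∈ y∈ = transposable-typeA x∈ y∈
transposable typeB   n w∈W x∈ y∈ = transposable-typeB w∈W x∈ y∈
transposable affineA n w∈W _  _  = transposable-affineA w∈W
transposable affineC n w∈W _  _  = transposable-affineC {n} w∈W

lemma3p4 : (n : ℕ) → 1 ℕ.≤ n → (W : GroupType) → (w : ℤ → ℤ) → InW W n w →
    ¬ IsIdentity W n w →
    ∃[ x ] ∃[ y ] (Transposable W n x y × y ≤ w x × x < y × w y ≤ x)
lemma3p4 n 1≤n W w w∈W w≢id =
  let x , y , x∈ , y∈ , x-y-crossing = crossing W n 1≤n w∈W w≢id in
  x , y , transposable W n w∈W x∈ y∈ x-y-crossing , x-y-crossing
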